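{- Let $G$ be a chordal graph with the base tree $T$ and overspan graphs defined in the context. Let $e$ be an edge of $T$, let $A_e$ be the overspan graph assigned to $e$, and let $C$ be a vertex cover of $A_e$. Define $S\subseteq V(G)$ by $S=C$ if $e$ is black, and $S=C\cup\{x\}$ if $e$ is red, where $x\in I$ is the vertex whose $I$-path $F_x$ corresponds to $e$. If vertices $u,v$ of $G-S$ form an $e$-enclosing pair, then $u$ and $v$ lie in different components of $G-S$.
   Context: A tree representation of a graph $G$ is a tree $T_0$ with a family $\mathcal F=\{F_v: v\in V(G)\}$ of subtrees of $T_0$ such that for distinct $u,v$, $uv\in E(G)$ iff $F_u$ and $F_v$ share a vertex. Fix one with $|V(T_0)|$ minimum. Choose an independent set $I$ of $G$ maximal with the property that for each $v\in I$, $F_v$ is a path all of whose vertices have degree at most $2$ in $T_0$; moreover $I$ is chosen so that for every $v\in I$, $F_v$ contains no member of $\mathcal F$ as a proper subgraph. For $v\in I$, $F_v$ is an $I$-path (trivial if it is a single vertex, which is then its endvertex). Colour each edge of $T_0$ red if it lies in some $I$-path and black otherwise. The base tree $T$ is obtained from $T_0$ by suppressing, one by one, every degree-$2$ vertex that is not an endvertex of any $I$-path; edges of $T$ inherit the colours, and each red edge of $T$ corresponds to a unique non-trivial $I$-path (the one it replaces). The vertices of $T_0$ that remain in $T$ are called substantial. For an edge $e=rs$ of $T$, the overspan graph $A_e$ has vertex set $V(G)\setminus I$; it has a loop at $v$ if $F_v$ contains both $r$ and $s$, and an edge between distinct $u,v$ if $uv\in E(G)$ and ($r\in V(F_u)$,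 $s\in V(F_v)$ or vice versa). A vertex cover of $A_e$ is a set of vertices meeting every edge, including loops (so looped vertices belong to it). Two vertices $u,v$ of $G$ form an $e$-enclosing pair if there are substantial vertices $s\in V(F_u)$ and $t\in V(F_v)$ lying in different components of $T-e$. -}

module Defs where

open import Data.Nat using (ℕ; _≤_; _<_; _+_; suc)
open import Data.Fin using (Fin; toℕ)
open import Data.List using (List; []; _∷_; _++_; [_]; length; lookup)
open import Data.List.Membership.Propositional using (_∈_)
open import Data.List.Relation.Unary.All using (All)
open import Data.List.Relation.Unary.Unique.Propositional using (Unique)
open import Data.List.Relation.Unary.Linked using (Linked)
open import Data.Product using (Σ; ∃; ∃-syntax; _×_; _,_)
open import Data.Sum using (_⊎_)
open import Data.Unit using (⊤)
open import Function.Bundles using (_⇔_)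
open import Relation.Nullary using (¬_)
open import Relation.Binary.PropositionalEquality using (_≡_; _≢_)

VSet : ℕ → Set₁
VSet k = Fin k → Set

record Graph (k : ℕ) : Set₁ where
  field
    Adj    : Fin k → Fin k → Set
    sym    : ∀ {u v} → Adj u v → Adj v u
    irrefl : ∀ {u} → ¬ Adj u u

data Walk {k : ℕ} (A : Fin k → Fin k → Set) (P : VSet k) : Fin k → Fin k → Set where
  here : ∀ {u} → P u → Walk A P u u
  step : ∀ {u w v} → P u → A u w → Walk A P w v → Walk A P u v

ConnectedIn : ∀ {k} → (Fin k → Fin k → Set) → VSet k → Set
ConnectedIn A P = ∀ u v → P u → P v → Walk A P u v

record Cycle {k : ℕ} (A : Fin k → Fin k → Set) : Set where
  field
    start  : Fin k
    rest   : List (Fin k)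
    long   : 2 ≤ length rest
    uniq   : Unique (start ∷ rest)
    linked : Linked A (start ∷ rest ++ [ start ])

-- G is chordal: every cycle of length at least 4 has a chord
-- (an edge of G joining two vertices that are not consecutive on the cycle)
Chordal : ∀ {k} → Graph k → Set
Chordal {k} G = (c : Cycle Adj) → 3 ≤ length (Cycle.rest c) →
  Σ (Fin (suc (length (Cycle.rest c)))) λ i →
  Σ (Fin (suc (length (Cycle.rest c)))) λ j →
    (suc (toℕ i) < toℕ j) ×
    ¬ (toℕ i ≡ 0 × suc (toℕ j) ≡ suc (length (Cycle.rest c))) ×
    Adj (lookup (Cycle.start c ∷ Cycle.rest c) i)
        (lookup (Cycle.start c ∷ Cycle.rest c) j)
  where open Graph G

record Tree (k : ℕ) : Set₁ where
  field
    graph    : Graph k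
    nonempty : 0 < k
  open Graph graph public
  field
    connected : ConnectedIn Adj (λ _ → ⊤)
    acyclic   : ¬ Cycle Adj

Subtree : ∀ {k} → Tree k → VSet k → Set
Subtree T F = (∃ λ t → F t) × ConnectedIn (Tree.Adj T) F

TreeRep : ∀ {n m} → Graph n → Tree m → (Fin n → VSet m) → Set
TreeRep {n} {m} G T F =
  (∀ v → Subtree T (F v)) ×
  (∀ u v → u ≢ v → (Graph.Adj G u v ⇔ (∃ λ t → F u t × F v t)))

module TreeNotions {m : ℕ} (T : Tree m) where
  open Tree T

  DegAtMost2 : Fin m → Set
  DegAtMost2 t = ∀ a b c → Adj t a → Adj t b → Adj t c →
                 a ≡ b ⊎ a ≡ c ⊎ b ≡ c

  Deg2 : Fin m → Set
  Deg2 t = ∃ λ a → ∃ λ b → a ≢ b × Adj t a × Adj t b ×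
           (∀ c → Adj t c → c ≡ a ⊎ c ≡ b)

  IsPath : VSet m → Set
  IsPath F = ∃ λ (l : List (Fin m)) → Unique l × Linked Adj l ×
             (∀ t → F t ⇔ t ∈ l)

  -- t is an endvertex of the path F (at most one neighbour in F;
  -- for a trivial path the single vertex is its endvertex)
  EndVertex : VSet m → Fin m → Set
  EndVertex F t = F t × (∀ a b → F a → F b → Adj t a → Adj t b → a ≡ b)

Independent : ∀ {n} → Graph n → VSet n → Set
Independent G J = ∀ u v → J u → J v → ¬ Graph.Adj G u v

record BaseSetup (n m : ℕ) : Set₁ where
  field
    G       : Graph n
    chordal : Chordal G
    T₀      : Tree m
    F       : Fin n → VSet m
    rep     : TreeRep G T₀ F
    minimum : ∀ m' (T' : Tree m') (F' : Fin n → VSet m') →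
              TreeRep G T' F' → m ≤ m'
  open TreeNotions T₀ public

  PathShape : Fin n → Set
  PathShape v = IsPath (F v) × (∀ t → F v t → DegAtMost2 t)

  field
    I         : VSet n
    I-indep   : Independent G I
    I-shape   : ∀ v → I v → PathShape v
    I-maximal : (J : VSet n) → (∀ v → I v → J v) → Independent G J →
                (∀ v → J v → PathShape v) → ∀ v → J v → I v
    I-minimal : ∀ v → I v → ¬ (∃ λ u → (∀ t → F u t → F v t) ×
                                       ¬ (∀ t → F v t → F u t))

  open Tree T₀ public using (Adj)

  Red₀ : Fin m → Fin m → Set
  Red₀ a b = ∃ λ x → I x × F x a × F x b

  -- vertices suppressed when passing from T₀ to the base tree T
  Suppressed : Fin m → Set
  Suppressed t = Deg2 t × ¬ (∃ λ x → I x × EndVertex (F x) t)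

  Substantial : Fin m → Set
  Substantial t = ¬ Suppressed t

  -- a T₀-path a , mid , b that becomes a single edge of T
  EdgePath : Fin m → List (Fin m) → Fin m → Set
  EdgePath a mid b = Substantial a × Substantial b × All Suppressed mid ×
                     Unique (a ∷ mid ++ [ b ]) × Linked Adj (a ∷ mid ++ [ b ])

  -- adjacency of the base tree T (on substantial vertices)
  TAdj : Fin m → Fin m → Set
  TAdj a b = ∃ λ mid → EdgePath a mid b

  record TEdge : Set where
    field
      r    : Fin m
      s    : Fin m
      mid  : List (Fin m)
      path : EdgePath r mid s

    verts : List (Fin m)
    verts = r ∷ mid ++ [ s ]

    -- colour inherited from T₀ (all replaced T₀ edges black)
    Black : Set
    Black = Linked (λ a b → ¬ Red₀ a b) verts

    Corresponds : Fin n → Set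
    Corresponds x = I x × (∀ t → F x t ⇔ t ∈ verts)

    TAdj-e : Fin m → Fin m → Set
    TAdj-e a b = TAdj a b × ¬ ((a ≡ r × b ≡ s) ⊎ (a ≡ s × b ≡ r))

    -- vertex cover of the overspan graph A_e (vertex set V(G) ∖ I)
    VertexCover : VSet n → Set
    VertexCover C =
      (∀ v → C v → ¬ I v) ×
      (∀ v → ¬ I v → F v r → F v s → C v) ×
      (∀ u v → ¬ I u → ¬ I v → u ≢ v → Graph.Adj G u v →
         (F u r × F v s) ⊎ (F u s × F v r) → C u ⊎ C v)

    Enclosing : Fin n → Fin n → Set
    Enclosing u v = ∃ λ a → ∃ λ b → Substantial a × F u a ×
                    Substantial b × F v b × ¬ Walk TAdj-e Substantial a b

module Submission where

-- Let e = rs replace the T₀-path r = p₀, …, p_{L+1} = s with suppressed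
-- interior, and cut T₀ open along e (delete the interior, and the edge rs
-- if L = 0).  First, e is black or F_x equals its path (`colour`).  Then
-- for w ∉ S: F_w avoids the interior if w ∈ I, never contains both r and
-- s, contains r or s if it meets the interior, and adjacent such subtrees
-- meeting in the interior share an end (using the cover C and the
-- maximality/minimality of I).  Hence along a walk u … v in G - S, with
-- a ∈ F_u, all of F_v outside the interior is reachable from a in the cut
-- tree (`Reach`); a cut-tree path between substantial vertices collapses
-- to a walk in T - e (`ToBaseTree`), contradicting enclosure.  We reason
-- classically in the double-negation monad; the goal is a negation.

open import Defs
open import Level using (0ℓ)
open import Data.Empty using (⊥; ⊥-elim)
open import Data.Nat using (ℕ; zero; suc; _+_; _∸_; _≤_; _<_; z≤n; s≤s)
open import Data.Nat.Properties using (≤-refl; ≤-trans; n≤1+n; m≤n⇒m<n∨m≡n; ≤-pred; +-comm; _≤?_; ≰⇒>;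
  <-trans; <-irrefl; ≤∧≢⇒<; ≤-<-trans; <⇒≤; +-suc; m≤n+m; m∸n+n≡m; ∸-monoˡ-≤; +-monoˡ-≤;
  <-≤-trans; ≮⇒≥)
import Data.Nat.Properties as ℕ
open import Data.Fin using (Fin)
open import Data.Fin.Properties using (_≟_)
open import Data.List using (List; []; _∷_; _++_; [_]; length; reverse; applyUpTo)
open import Data.List.Properties using (++-assoc; unfold-reverse; reverse-++; reverse-selfInverse; length-++; ++-conicalʳ)
open import Data.List.Membership.Propositional using (_∈_; _∉_)
import Data.List.Membership.DecPropositional as DecMembership
open import Data.List.Membership.Propositional.Properties using (∈-++⁺ˡ; ∈-++⁺ʳ; ∈-++⁻; ∈-applyUpTo⁺; ∈-applyUpTo⁻)
open import Data.List.Relation.Binary.Disjoint.Propositional using (Disjoint)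
open import Data.List.Relation.Unary.Any using (here; there)
import Data.List.Relation.Unary.Any.Properties as Any
open import Data.List.Relation.Unary.All using (All; []; _∷_) renaming (lookup to All-lookup)
import Data.List.Relation.Unary.All.Properties as All
open import Data.List.Relation.Unary.AllPairs using ([]; _∷_)
open import Data.List.Relation.Unary.Unique.Propositional using (Unique)
import Data.List.Relation.Unary.Unique.Propositional.Properties as Unique
open import Data.List.Relation.Unary.Linked using (Linked; []; [-]; _∷_) renaming (map to Linked-map)
import Data.List.Relation.Unary.Linked.Properties as Linked
open import Data.Product using (Σ; ∃; _×_; _,_; proj₁; proj₂)
open import Data.Sum using (_⊎_; inj₁; inj₂)
open import Effect.Monad using (RawMonad)
open import Function.Base using (case_of_)
open import Function.Bundles using (_⇔_; mk⇔; Equivalence)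
open import Relation.Nullary.Negation using (¬_; ¬¬-Monad; contradiction)
open import Relation.Nullary.Decidable.Core using (Dec; yes; no; ¬¬-excluded-middle)
open import Relation.Binary.PropositionalEquality
  using (_≡_; _≢_; refl; sym; trans; cong; subst; module ≡-Reasoning)

open RawMonad (¬¬-Monad {0ℓ}) using (_>>=_; pure)

_∈?_ : ∀ {k} (x : Fin k) (xs : List (Fin k)) → Dec (x ∈ xs)
x ∈? xs = DecMembership._∈?_ _≟_ x xs

module _ {k : ℕ} {A : Fin k → Fin k → Set} {P : VSet k} where

  vertices : ∀ {u v} → Walk A P u v → List (Fin k)
  vertices (here {u} _) = u ∷ []
  vertices (step {u} _ _ p) = u ∷ vertices p

  initVertices : ∀ {u v} → Walk A P u v → List (Fin k)
  initVertices (here _) = []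
  initVertices (step {u} _ _ p) = u ∷ initVertices p

  vertices-init : ∀ {u v} (p : Walk A P u v) → vertices p ≡ initVertices p ++ [ v ]
  vertices-init (here _) = refl
  vertices-init (step _ _ p) = cong (_ ∷_) (vertices-init p)

  walkStart : ∀ {u v} → Walk A P u v → P u
  walkStart (here pu) = pu
  walkStart (step pu _ _) = pu

  vertices-All : ∀ {u v} (p : Walk A P u v) → All P (vertices p)
  vertices-All (here pu) = pu ∷ []
  vertices-All (step pu _ p) = pu ∷ vertices-All p

  vertices-Linked : ∀ {u v} (p : Walk A P u v) → Linked A (vertices p)
  vertices-Linked (here _) = [-]
  vertices-Linked (step _ a (here _)) = a ∷ [-]
  vertices-Linked (step _ a (step pw b p)) = a ∷ vertices-Linked (step pw b p)

  _++ʷ_ : ∀ {u w v} → Walk A P u w → Walk A P w v → Walk A P u v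
  here _ ++ʷ q = q
  step pu a p ++ʷ q = step pu a (p ++ʷ q)

  suffixFrom : ∀ {u w v} (p : Walk A P w v) → Unique (vertices p) → u ∈ vertices p →
               Σ (Walk A P u v) (λ q → Unique (vertices q))
  suffixFrom (here pu) U (here refl) = here pu , U
  suffixFrom (step pw a p) U (here refl) = step pw a p , U
  suffixFrom (step _ _ p) (_ ∷ U) (there u∈p) = suffixFrom p U u∈p

  loopErase : ∀ {u v} → Walk A P u v → Σ (Walk A P u v) (λ q → Unique (vertices q))
  loopErase (here pu) = here pu , [] ∷ []
  loopErase (step {u} pu a p) with loopErase p
  ... | q , U with u ∈? vertices q
  ...   | yes u∈q = suffixFrom q U u∈q
  ...   | no u∉q = step pu a q , All.¬Any⇒All¬ _ u∉q ∷ U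

  exitEdge : ∀ (xs : List (Fin k)) {z y} → Walk A P z y → z ∈ xs → y ∉ xs →
             ∃ λ z₁ → ∃ λ z₂ → z₁ ∈ xs × z₂ ∉ xs × P z₁ × P z₂ × A z₁ z₂
  exitEdge xs (here _) z∈ y∉ = contradiction z∈ y∉
  exitEdge xs {z} (step {w = w} pz a p) z∈ y∉ with w ∈? xs
  ... | yes w∈ = exitEdge xs p w∈ y∉
  ... | no w∉ = z , w , z∈ , w∉ , pz , walkStart p , a

walkMap : ∀ {k} {A A' : Fin k → Fin k → Set} {P P' : VSet k} →
          (∀ {x} → P x → P' x) → (∀ {x y} → P x → P y → A x y → A' x y) →
          ∀ {u v} → Walk A P u v → Walk A' P' u v
walkMap f g (here px) = here (f px)
walkMap f g (step px a p) = step (f px) (g px (walkStart p) a) (walkMap f g p)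

module _ {k : ℕ} where

  Unique-++ˡ : ∀ (xs : List (Fin k)) {ys} → Unique (xs ++ ys) → Unique xs
  Unique-++ˡ [] _ = []
  Unique-++ˡ (x ∷ xs) (x∉ ∷ U) = All.++⁻ˡ xs x∉ ∷ Unique-++ˡ xs U

  Unique-++ʳ : ∀ (xs : List (Fin k)) {ys} → Unique (xs ++ ys) → Unique ys
  Unique-++ʳ [] U = U
  Unique-++ʳ (x ∷ xs) (_ ∷ U) = Unique-++ʳ xs U

  Unique-last : ∀ (xs : List (Fin k)) {y} → Unique (xs ++ [ y ]) → y ∉ xs
  Unique-last (x ∷ xs) (x∉ ∷ U) (here refl) = All-lookup x∉ (∈-++⁺ʳ xs (here refl)) refl
  Unique-last (x ∷ xs) (x∉ ∷ U) (there y∈) = Unique-last xs U y∈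

  Unique-cut : ∀ (xs : List (Fin k)) {y ys} → Unique (xs ++ y ∷ ys) → Unique (xs ++ [ y ])
  Unique-cut xs {y} {ys} U = Unique-++ˡ (xs ++ [ y ]) (subst Unique (sym (++-assoc xs [ y ] ys)) U)

  Linked-join : ∀ {R : Fin k → Fin k → Set} (xs : List (Fin k)) {y ys} →
                Linked R (xs ++ [ y ]) → Linked R (y ∷ ys) → Linked R (xs ++ y ∷ ys)
  Linked-join [] _ l = l
  Linked-join (x ∷ []) (r ∷ _) l = r ∷ l
  Linked-join (x ∷ x' ∷ xs) (r ∷ l₁) l = r ∷ Linked-join (x' ∷ xs) l₁ l

  Linked-reverse : ∀ {R : Fin k → Fin k → Set} → (∀ {x y} → R x y → R y x) →
                   ∀ {xs} → Linked R xs → Linked R (reverse xs)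
  Linked-reverse sym-R [] = []
  Linked-reverse sym-R [-] = [-]
  Linked-reverse {R} sym-R {x ∷ y ∷ ys} (r ∷ l) =
    subst (Linked R) (sym reversal)
      (Linked-join (reverse ys) (subst (Linked R) (unfold-reverse y ys) (Linked-reverse sym-R l))
                   (sym-R r ∷ [-]))
    where
    open ≡-Reasoning
    reversal : reverse (x ∷ y ∷ ys) ≡ reverse ys ++ y ∷ [ x ]
    reversal = begin
      reverse (x ∷ y ∷ ys)           ≡⟨ unfold-reverse x (y ∷ ys) ⟩
      reverse (y ∷ ys) ++ [ x ]      ≡⟨ cong (_++ [ x ]) (unfold-reverse y ys) ⟩
      (reverse ys ++ [ y ]) ++ [ x ] ≡⟨ ++-assoc (reverse ys) [ y ] [ x ] ⟩
      reverse ys ++ y ∷ [ x ]        ∎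

  Unique-reverse : ∀ {xs : List (Fin k)} → Unique xs → Unique (reverse xs)
  Unique-reverse [] = []
  Unique-reverse {x ∷ xs} (x∉ ∷ U) =
    subst Unique (sym (unfold-reverse x xs)) (Unique.++⁺ (Unique-reverse U) ([] ∷ []) disjoint)
    where
    disjoint : Disjoint (reverse xs) [ x ]
    disjoint (t∈ , here refl) = All-lookup x∉ (Any.reverse⁻ t∈) refl

-- Positions in a list: `at d xs i` is the i-th entry of xs (d if out of
-- range).  Positions turn the edge path of e into a sequence of vertices
-- indexed by 0 … L+1.
at : ∀ {k} → Fin k → List (Fin k) → ℕ → Fin k
at d [] _ = d
at d (x ∷ xs) zero = x
at d (x ∷ xs) (suc i) = at d xs i

module _ {k : ℕ} {d : Fin k} where

  at-∈ : ∀ xs i → i < length xs → at d xs i ∈ xs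
  at-∈ (x ∷ xs) zero _ = here refl
  at-∈ (x ∷ xs) (suc i) (s≤s i<) = there (at-∈ xs i i<)

  ∈-at : ∀ {t} xs → t ∈ xs → ∃ λ i → i < length xs × at d xs i ≡ t
  ∈-at (x ∷ xs) (here refl) = 0 , s≤s z≤n , refl
  ∈-at (x ∷ xs) (there t∈) with ∈-at xs t∈
  ... | i , i< , eq = suc i , s≤s i< , eq

  at-injective : ∀ {xs} → Unique xs → ∀ i j → i < length xs → j < length xs →
                 at d xs i ≡ at d xs j → i ≡ j
  at-injective (x∉ ∷ U) zero zero _ _ _ = refl
  at-injective {x ∷ xs} (x∉ ∷ U) zero (suc j) _ (s≤s j<) eq = contradiction eq (All-lookup x∉ (at-∈ xs j j<))
  at-injective {x ∷ xs} (x∉ ∷ U) (suc i) zero (s≤s i<) _ eq = contradiction (sym eq) (All-lookup x∉ (at-∈ xs i i<))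
  at-injective {x ∷ xs} (x∉ ∷ U) (suc i) (suc j) (s≤s i<) (s≤s j<) eq =
    cong suc (at-injective U i j i< j< eq)

  at-Linked : ∀ {R : Fin k → Fin k → Set} {xs} → Linked R xs → ∀ i → suc i < length xs →
              R (at d xs i) (at d xs (suc i))
  at-Linked (r ∷ _) zero _ = r
  at-Linked (_ ∷ l) (suc i) (s≤s i<) = at-Linked l i i<
  at-Linked [-] i (s≤s ())

  at-++ˡ : ∀ xs ys i → i < length xs → at d (xs ++ ys) i ≡ at d xs i
  at-++ˡ (x ∷ xs) ys zero _ = refl
  at-++ˡ (x ∷ xs) ys (suc i) (s≤s i<) = at-++ˡ xs ys i i<

  at-last : ∀ xs y → at d (xs ++ [ y ]) (length xs) ≡ y
  at-last [] y = refl
  at-last (x ∷ xs) y = at-last xs y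

¬¬-bounded-∀ : ∀ (P : ℕ → Set) B → (∀ j → j ≤ B → ¬ ¬ P j) → ¬ ¬ (∀ j → j ≤ B → P j)
¬¬-bounded-∀ P zero h = h 0 z≤n >>= λ p → pure λ { zero z≤n → p }
¬¬-bounded-∀ P (suc B) h =
  ¬¬-bounded-∀ P B (λ j j≤ → h j (≤-trans j≤ (n≤1+n B))) >>= λ below →
  h (suc B) ≤-refl >>= λ top → pure (combine below top)
  where
  combine : (∀ j → j ≤ B → P j) → P (suc B) → ∀ j → j ≤ suc B → P j
  combine below top j j≤ with m≤n⇒m<n∨m≡n j≤
  ... | inj₁ (s≤s j≤B) = below j j≤B
  ... | inj₂ refl = top

¬¬-step-of-¬Linked : ∀ {k} {R : Fin k → Fin k → Set} (d : Fin k) xs →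
  ¬ Linked (λ a b → ¬ R a b) xs →
  ¬ ¬ (∃ λ i → suc i < length xs × R (at d xs i) (at d xs (suc i)))
¬¬-step-of-¬Linked d [] ¬l = contradiction [] ¬l
¬¬-step-of-¬Linked d (x ∷ []) ¬l = contradiction [-] ¬l
¬¬-step-of-¬Linked {R = R} d (x ∷ y ∷ ys) ¬l = extend (¬¬-step-of-¬Linked d (y ∷ ys))
  where
  Step : List _ → Set
  Step zs = ∃ λ i → suc i < length zs × R (at d zs i) (at d zs (suc i))
  extend : (¬ Linked (λ a b → ¬ R a b) (y ∷ ys) → ¬ ¬ Step (y ∷ ys)) → ¬ ¬ Step (x ∷ y ∷ ys)
  extend ih = ¬¬-excluded-middle >>= λ
    { (yes rxy) → pure (0 , s≤s (s≤s z≤n) , rxy)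
    ; (no ¬rxy) → ih (λ l → ¬l (¬rxy ∷ l)) >>= λ { (i , i< , r) → pure (suc i , s≤s i< , r) } }

¬¬-least : ∀ (Pr : ℕ → Set) f k → k < f → Pr k →
           ¬ ¬ (Σ ℕ λ lo → Pr lo × (∀ i → Pr i → lo ≤ i))
¬¬-least Pr (suc f) k (s≤s k≤f) pk = ¬¬-excluded-middle >>= descend
  where
  descend : Dec (∃ λ i → i < k × Pr i) → ¬ ¬ (Σ ℕ λ lo → Pr lo × (∀ i → Pr i → lo ≤ i))
  descend (yes (i , i<k , pi)) = ¬¬-least Pr f i (<-≤-trans i<k k≤f) pi
  descend (no none) = pure (k , pk , λ i pi → ≮⇒≥ (λ i<k → none (i , i<k , pi)))

¬¬-greatest : ∀ (Pr : ℕ → Set) d k → (∀ i → Pr i → i ≤ d) → Pr k →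
              ¬ ¬ (Σ ℕ λ hi → Pr hi × (∀ i → Pr i → i ≤ hi))
¬¬-greatest Pr zero k bd pk = pure (k , pk , λ i pi → ≤-trans (bd i pi) z≤n)
¬¬-greatest Pr (suc d) k bd pk = ¬¬-excluded-middle >>= ascend
  where
  lower : ∀ i → Pr i → ¬ Pr (suc d) → i ≤ d
  lower i pi ¬top with m≤n⇒m<n∨m≡n (bd i pi)
  ... | inj₁ (s≤s i≤d) = i≤d
  ... | inj₂ refl = contradiction pi ¬top
  ascend : Dec (Pr (suc d)) → ¬ ¬ (Σ ℕ λ hi → Pr hi × (∀ i → Pr i → i ≤ hi))
  ascend (yes top) = pure (suc d , top , bd)
  ascend (no ¬top) = ¬¬-greatest Pr d k (λ i pi → lower i pi ¬top) pk

-- In a tree, two paths x … z and z … x with disjoint interiors, not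
-- both single edges, would close a cycle.
no-two-paths : ∀ {k} (T : Tree k) (x z : Fin k) (M Q : List (Fin k)) →
  Unique (x ∷ M ++ [ z ]) → Linked (Tree.Adj T) (x ∷ M ++ [ z ]) →
  Unique (z ∷ Q ++ [ x ]) → Linked (Tree.Adj T) (z ∷ Q ++ [ x ]) →
  Disjoint M Q → ¬ (M ≡ [] × Q ≡ []) → ⊥
no-two-paths T x z M Q U₁ L₁ U₂ L₂ M∩Q≡∅ nonempty = Tree.acyclic T cycle
  where
  long : ∀ M Q → ¬ (M ≡ [] × Q ≡ []) → 2 ≤ length (M ++ z ∷ Q)
  long [] [] ne = contradiction (refl , refl) ne
  long [] (_ ∷ _) _ = s≤s (s≤s z≤n)
  long (_ ∷ []) _ _ = s≤s (s≤s z≤n)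
  long (_ ∷ _ ∷ _) _ _ = s≤s (s≤s z≤n)
  disjoint : Disjoint (x ∷ M) (z ∷ Q)
  disjoint (here e₁ , here e₂) = Unique-last (x ∷ M) U₁ (here (trans (sym e₂) e₁))
  disjoint (here e₁ , there t∈Q) = Unique-last (z ∷ Q) U₂ (there (subst (_∈ Q) e₁ t∈Q))
  disjoint (there t∈M , here e₂) = Unique-last (x ∷ M) U₁ (there (subst (_∈ M) e₂ t∈M))
  disjoint (there t∈M , there t∈Q) = M∩Q≡∅ (t∈M , t∈Q)
  cycle : Cycle (Tree.Adj T)
  cycle = record
    { start = x ; rest = M ++ z ∷ Q ; long = long M Q nonempty
    ; uniq = Unique.++⁺ (Unique-++ˡ (x ∷ M) U₁) (Unique-++ˡ (z ∷ Q) U₂) disjoint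
    ; linked = subst (λ l → Linked (Tree.Adj T) (x ∷ l)) (sym (++-assoc M (z ∷ Q) [ x ]))
                     (Linked-join (x ∷ M) L₁ L₂) }

-- The edge e = rs of the base tree T replaces the T₀-path
-- r = p₀, p₁, …, p_L, p_{L+1} = s whose interior vertices p₁ … p_L
-- ("mid") are suppressed, hence of degree 2 in T₀.
module EdgePath {n m : ℕ} (B : BaseSetup n m) (e : BaseSetup.TEdge B) where
  open BaseSetup B
  open BaseSetup.TEdge e

  Adj-sym : ∀ {x y} → Adj x y → Adj y x
  Adj-sym = Tree.sym T₀

  subtree-connected : ∀ w → ConnectedIn Adj (F w)
  subtree-connected w = proj₂ (proj₁ rep w)

  share→adj : ∀ {u v t} → u ≢ v → F u t → F v t → Graph.Adj G u v
  share→adj {u} {v} {t} u≢v fu fv = Equivalence.from (proj₂ rep u v u≢v) (t , fu , fv)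

  adj→share : ∀ {u v} → Graph.Adj G u v → ∃ λ t → F u t × F v t
  adj→share {u} {v} a = Equivalence.to (proj₂ rep u v (λ { refl → Graph.irrefl G a })) a

  r-substantial : Substantial r
  r-substantial = proj₁ path

  s-substantial : Substantial s
  s-substantial = proj₁ (proj₂ path)

  interior-suppressed : All Suppressed mid
  interior-suppressed = proj₁ (proj₂ (proj₂ path))

  verts-unique : Unique verts
  verts-unique = proj₁ (proj₂ (proj₂ (proj₂ path)))

  verts-linked : Linked Adj verts
  verts-linked = proj₂ (proj₂ (proj₂ (proj₂ path)))

  L : ℕ
  L = length mid

  p : ℕ → Fin m
  p i = at r verts i

  length-verts : length verts ≡ suc (suc L)
  length-verts = cong suc (trans (length-++ mid) (+-comm L 1))

  in-range : ∀ {i} → i ≤ suc L → i < length verts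
  in-range {i} i≤ = subst (i <_) (sym length-verts) (s≤s i≤)

  p-last : p (suc L) ≡ s
  p-last = at-last mid s

  p-interior : ∀ k → k < L → p (suc k) ∈ mid
  p-interior k k< = subst (_∈ mid) (sym (at-++ˡ mid [ s ] k k<)) (at-∈ mid k k<)

  interior-p : ∀ {t} → t ∈ mid → ∃ λ k → k < L × p (suc k) ≡ t
  interior-p t∈ with ∈-at {d = r} mid t∈
  ... | k , k< , eq = k , k< , trans (at-++ˡ mid [ s ] k k<) eq

  p-injective : ∀ {i j} → i ≤ suc L → j ≤ suc L → p i ≡ p j → i ≡ j
  p-injective i≤ j≤ = at-injective verts-unique _ _ (in-range i≤) (in-range j≤)

  p-adjacent : ∀ {i} → i ≤ L → Adj (p i) (p (suc i))
  p-adjacent i≤ = at-Linked verts-linked _ (in-range (s≤s i≤))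

  p-∈ : ∀ {i} → i ≤ suc L → p i ∈ verts
  p-∈ i≤ = at-∈ verts _ (in-range i≤)

  ∈-p : ∀ {t} → t ∈ verts → ∃ λ i → i ≤ suc L × p i ≡ t
  ∈-p t∈ with ∈-at {d = r} verts t∈
  ... | i , i< , eq = i , ≤-pred (subst (i <_) length-verts i<) , eq

  interior⊆verts : ∀ {t} → t ∈ mid → t ∈ verts
  interior⊆verts t∈ = there (∈-++⁺ˡ t∈)

  r∉mid : r ∉ mid
  r∉mid r∈ with verts-unique
  ... | r∉ ∷ _ = All-lookup r∉ (∈-++⁺ˡ r∈) refl

  s∉mid : s ∉ mid
  s∉mid s∈ with verts-unique
  ... | _ ∷ U = Unique-last mid U s∈

  r≢s : r ≢ s
  r≢s eq with verts-unique
  ... | r∉ ∷ _ = All-lookup r∉ (∈-++⁺ʳ mid (here refl)) eq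

  verts-cases : ∀ {t} → t ∈ verts → t ≡ r ⊎ t ∈ mid ⊎ t ≡ s
  verts-cases (here eq) = inj₁ eq
  verts-cases (there t∈) with ∈-++⁻ mid t∈
  ... | inj₁ t∈mid = inj₂ (inj₁ t∈mid)
  ... | inj₂ (here eq) = inj₂ (inj₂ eq)

  -- an interior vertex p_{k+1} is suppressed, so its only T₀-neighbours
  -- are its two path neighbours p_k and p_{k+2}
  interior-neighbours : ∀ {k y} → k < L → Adj (p (suc k)) y → y ≡ p k ⊎ y ≡ p (suc (suc k))
  interior-neighbours {k} {y} k< a with All-lookup interior-suppressed (p-interior k k<)
  ... | (a₀ , b₀ , _ , _ , _ , only) , _ =
    sort (only _ (Adj-sym (p-adjacent (≤-trans (n≤1+n k) k<)))) (only _ (p-adjacent k<)) (only y a)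
    where
    distinct : p k ≢ p (suc (suc k))
    distinct eq with p-injective (≤-trans (n≤1+n k) (≤-trans (n≤1+n _) (s≤s k<))) (s≤s k<) eq
    ... | ()
    sort : p k ≡ a₀ ⊎ p k ≡ b₀ → p (suc (suc k)) ≡ a₀ ⊎ p (suc (suc k)) ≡ b₀ → y ≡ a₀ ⊎ y ≡ b₀ →
           y ≡ p k ⊎ y ≡ p (suc (suc k))
    sort (inj₁ ea) (inj₁ eb) _ = contradiction (trans ea (sym eb)) distinct
    sort (inj₂ ea) (inj₂ eb) _ = contradiction (trans ea (sym eb)) distinct
    sort (inj₁ ea) (inj₂ eb) (inj₁ ey) = inj₁ (trans ey (sym ea))
    sort (inj₁ ea) (inj₂ eb) (inj₂ ey) = inj₂ (trans ey (sym eb))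
    sort (inj₂ ea) (inj₁ eb) (inj₁ ey) = inj₂ (trans ey (sym eb))
    sort (inj₂ ea) (inj₁ eb) (inj₂ ey) = inj₁ (trans ey (sym ea))

  interior-neighbour : ∀ {t y} → t ∈ mid → Adj t y → y ≡ r ⊎ y ≡ s ⊎ y ∈ mid
  interior-neighbour t∈ a with interior-p t∈
  ... | k , k< , refl with interior-neighbours k< a
  interior-neighbour _ _ | zero , k< , refl | inj₁ eq = inj₁ eq
  interior-neighbour _ _ | suc k , k< , refl | inj₁ eq =
    inj₂ (inj₂ (subst (_∈ mid) (sym eq) (p-interior k (≤-trans (n≤1+n _) k<))))
  interior-neighbour _ _ | k , k< , refl | inj₂ eq with m≤n⇒m<n∨m≡n k<
  ... | inj₁ k+1< = inj₂ (inj₂ (subst (_∈ mid) (sym eq) (p-interior (suc k) k+1<)))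
  ... | inj₂ k+1≡L = inj₂ (inj₁ (trans eq (trans (cong (λ j → p (suc j)) k+1≡L) p-last)))

  interior-degree≤2 : ∀ {t} → t ∈ mid → DegAtMost2 t
  interior-degree≤2 t∈ a b c ta tb tc with All-lookup interior-suppressed t∈
  ... | (a₀ , b₀ , _ , _ , _ , only) , _ = pigeonhole (only a ta) (only b tb) (only c tc)
    where
    pigeonhole : a ≡ a₀ ⊎ a ≡ b₀ → b ≡ a₀ ⊎ b ≡ b₀ → c ≡ a₀ ⊎ c ≡ b₀ → a ≡ b ⊎ a ≡ c ⊎ b ≡ c
    pigeonhole (inj₁ ea) (inj₁ eb) _ = inj₁ (trans ea (sym eb))
    pigeonhole (inj₂ ea) (inj₂ eb) _ = inj₁ (trans ea (sym eb))
    pigeonhole (inj₁ ea) _ (inj₁ ec) = inj₂ (inj₁ (trans ea (sym ec)))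
    pigeonhole (inj₂ ea) _ (inj₂ ec) = inj₂ (inj₁ (trans ea (sym ec)))
    pigeonhole _ (inj₁ eb) (inj₁ ec) = inj₂ (inj₂ (trans eb (sym ec)))
    pigeonhole _ (inj₂ eb) (inj₂ ec) = inj₂ (inj₂ (trans eb (sym ec)))

  -- The path r … s is the only T₀-path between r and s: a second one
  -- avoiding the interior would have to be the edge rs itself with mid
  -- empty.  We need it in both orientations.
  unique-path-sr : ∀ Q → Unique (s ∷ Q ++ [ r ]) → Linked Adj (s ∷ Q ++ [ r ]) →
                   (∀ {t} → t ∈ Q → t ∉ mid) → ¬ (mid ≡ [] × Q ≡ []) → ⊥
  unique-path-sr Q U Lk avoid =
    no-two-paths T₀ r s mid Q verts-unique verts-linked U Lk (λ (t∈mid , t∈Q) → avoid t∈Q t∈mid)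

  reverse-verts : reverse verts ≡ s ∷ reverse mid ++ [ r ]
  reverse-verts = begin
    reverse (r ∷ mid ++ [ s ])      ≡⟨ unfold-reverse r (mid ++ [ s ]) ⟩
    reverse (mid ++ [ s ]) ++ [ r ] ≡⟨ cong (_++ [ r ]) (reverse-++ mid [ s ]) ⟩
    s ∷ reverse mid ++ [ r ]        ∎
    where open ≡-Reasoning

  unique-path-rs : ∀ Q → Unique (r ∷ Q ++ [ s ]) → Linked Adj (r ∷ Q ++ [ s ]) →
                   (∀ {t} → t ∈ Q → t ∉ mid) → ¬ (mid ≡ [] × Q ≡ []) → ⊥
  unique-path-rs Q U Lk avoid nonempty =
    no-two-paths T₀ s r (reverse mid) Q
      (subst Unique reverse-verts (Unique-reverse verts-unique))
      (subst (Linked Adj) reverse-verts (Linked-reverse Adj-sym verts-linked))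
      U Lk (λ (t∈rev , t∈Q) → avoid t∈Q (Any.reverse⁻ t∈rev))
      (λ (rev≡[] , Q≡[]) → nonempty (sym (reverse-selfInverse rev≡[]) , Q≡[]))

  Colour : Set
  Colour = Black ⊎ Σ (Fin n) Corresponds

  module IPath {x : Fin n} (Ix : I x) where

    -- an interior vertex of the path is suppressed, so it is not an
    -- endvertex of the I-path F_x: F_x continues on both sides of it
    continues-back : ∀ {k} → k < L → F x (p (suc k)) → ¬ ¬ F x (p k)
    continues-back {k} k< fx ¬back =
      proj₂ (All-lookup interior-suppressed (p-interior k k<)) (x , Ix , fx , end)
      where
      end : ∀ a b → F x a → F x b → Adj (p (suc k)) a → Adj (p (suc k)) b → a ≡ b
      end a b fa fb ta tb with interior-neighbours k< ta | interior-neighbours k< tb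
      ... | inj₁ refl | _ = contradiction fa ¬back
      ... | inj₂ _ | inj₁ refl = contradiction fb ¬back
      ... | inj₂ ea | inj₂ eb = trans ea (sym eb)

    continues-forward : ∀ {k} → k < L → F x (p (suc k)) → ¬ ¬ F x (p (suc (suc k)))
    continues-forward {k} k< fx ¬fwd =
      proj₂ (All-lookup interior-suppressed (p-interior k k<)) (x , Ix , fx , end)
      where
      end : ∀ a b → F x a → F x b → Adj (p (suc k)) a → Adj (p (suc k)) b → a ≡ b
      end a b fa fb ta tb with interior-neighbours k< ta | interior-neighbours k< tb
      ... | inj₂ refl | _ = contradiction fa ¬fwd
      ... | inj₁ _ | inj₂ refl = contradiction fb ¬fwd
      ... | inj₁ ea | inj₁ eb = trans ea (sym eb)

    covers-below : ∀ i → F x (p i) → i ≤ L → ∀ t → t ≤ i → ¬ ¬ F x (p t)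
    covers-below zero f₀ _ zero z≤n = pure f₀
    covers-below (suc i) fi i< t t≤ with m≤n⇒m<n∨m≡n t≤
    ... | inj₂ refl = pure fi
    ... | inj₁ (s≤s t≤i) = continues-back i< fi >>= λ fi-1 →
                           covers-below i fi-1 (≤-trans (n≤1+n i) i<) t t≤i

    covers-above : ∀ i → F x (p (suc i)) → ∀ t → suc i ≤ t → t ≤ suc L → ¬ ¬ F x (p t)
    covers-above i fi+1 (suc t) (s≤s i≤t) t≤ with m≤n⇒m<n∨m≡n i≤t
    ... | inj₂ refl = pure fi+1
    covers-above i fi+1 (suc (suc t)) (s≤s i≤t) (s≤s t<) | inj₁ (s≤s i≤t') =
      covers-above i fi+1 (suc t) (s≤s i≤t') (≤-trans (n≤1+n _) (s≤s t<)) >>= λ ft →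
      continues-forward t< ft

    covers-path : ∀ i → i ≤ L → F x (p i) → F x (p (suc i)) → ¬ ¬ (∀ j → j ≤ suc L → F x (p j))
    covers-path i i≤ fi fi+1 = ¬¬-bounded-∀ (λ j → F x (p j)) (suc L) pointwise
      where
      pointwise : ∀ j → j ≤ suc L → ¬ ¬ F x (p j)
      pointwise j j≤ with j ≤? i
      ... | yes j≤i = covers-below i fi i≤ j j≤i
      ... | no j≰i = covers-above i fi+1 j (≰⇒> j≰i) j≤

    -- an I-path cannot pass through a substantial vertex z (every vertex
    -- of F_x has degree ≤ 2, so z would have degree 2 and, having two
    -- neighbours in F_x and meeting no other I-path, would be suppressed)
    not-through-substantial : ∀ {z a b} → Substantial z → F x z → F x a → F x b →
                              Adj z a → Adj z b → a ≢ b → ⊥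
    not-through-substantial {z} {a} {b} Sz fz fa fb za zb a≢b = Sz (degree-2 , not-end)
      where
      only : ∀ {c} → c ≡ a ⊎ c ≡ b ⊎ a ≡ b → c ≡ a ⊎ c ≡ b
      only (inj₁ eq) = inj₁ eq
      only (inj₂ (inj₁ eq)) = inj₂ eq
      only (inj₂ (inj₂ eq)) = contradiction eq a≢b
      degree-2 : Deg2 z
      degree-2 = a , b , a≢b , za , zb , λ c zc → only (proj₂ (I-shape x Ix) z fz c a b zc za zb)
      not-end : ¬ (∃ λ x' → I x' × EndVertex (F x') z)
      not-end (x' , Ix' , fz' , end) with x' ≟ x
      ... | yes refl = a≢b (end a b fa fb za zb)
      ... | no x'≢x = I-indep x' x Ix' Ix (share→adj x'≢x fz' fz)

    corresponds : (∀ j → j ≤ suc L → F x (p j)) → Corresponds x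
    corresponds covers = Ix , λ t → mk⇔ (inside t) (from-path t)
      where
      from-path : ∀ t → t ∈ verts → F x t
      from-path t t∈ with ∈-p t∈
      ... | i , i≤ , refl = covers i i≤
      inside : ∀ t → F x t → t ∈ verts
      inside t ft with t ∈? verts
      ... | yes t∈ = t∈
      ... | no t∉ with exitEdge verts (subtree-connected x r t (covers 0 z≤n) ft) (here refl) t∉
      ... | z₁ , z₂ , z₁∈ , z₂∉ , f₁ , f₂ , a₁₂ with verts-cases z₁∈
      ... | inj₁ refl = ⊥-elim (not-through-substantial r-substantial f₁ (covers 1 (s≤s z≤n)) f₂
                          (p-adjacent z≤n) a₁₂ (λ { refl → z₂∉ (p-∈ (s≤s z≤n)) }))
      ... | inj₂ (inj₂ refl) = ⊥-elim (not-through-substantial s-substantial f₁ (covers L (n≤1+n L)) f₂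
                          (Adj-sym (subst (Adj (p L)) p-last (p-adjacent ≤-refl))) a₁₂
                          (λ { refl → z₂∉ (p-∈ (n≤1+n L)) }))
      ... | inj₂ (inj₁ z₁∈mid) with interior-neighbour z₁∈mid a₁₂
      ... | inj₁ refl = ⊥-elim (z₂∉ (here refl))
      ... | inj₂ (inj₁ refl) = ⊥-elim (z₂∉ (there (∈-++⁺ʳ mid (here refl))))
      ... | inj₂ (inj₂ z₂∈mid) = ⊥-elim (z₂∉ (interior⊆verts z₂∈mid))

  -- if some T₀-edge of the path is red, the I-path containing it is F_x
  -- for an x corresponding to e
  colour : ¬ ¬ Colour
  colour = ¬¬-excluded-middle >>= λ
    { (yes black) → pure (inj₁ black)
    ; (no ¬black) → ¬¬-step-of-¬Linked r verts ¬black >>= λ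
        { (i , i< , (x , Ix , fi , fi+1)) →
          IPath.covers-path Ix i (≤-pred (≤-pred (subst (suc i <_) length-verts i<))) fi fi+1 >>= λ covers →
          pure (inj₂ (x , IPath.corresponds Ix covers)) } }

  black-edge : Black → ∀ {i} → i ≤ L → ¬ Red₀ (p i) (p (suc i))
  black-edge black i≤ = at-Linked black _ (in-range (s≤s i≤))

  black-edge-rs : Black → mid ≡ [] → ¬ Red₀ r s
  black-edge-rs black mid≡[] with subst (λ l → Linked (λ a b → ¬ Red₀ a b) (r ∷ l ++ [ s ])) mid≡[] black
  ... | ¬red ∷ _ = ¬red

  -- A connected set P of interior vertices is the vertex set of a T₀-path:
  -- the segment p_{lo+1} … p_{hi+1} between its least and greatest position.
  module InteriorSegment (P : VSet m) (P-connected : ConnectedIn Adj P)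
                         (P⊆mid : ∀ y → P y → y ∈ mid) where

    At : ℕ → Set
    At k = k < L × P (p (suc k))

    between : ∀ {y z c k h} → Walk Adj P y z → y ≡ p (suc c) → c < k →
              z ≡ p (suc h) → k < h → h < L → P (p (suc k))
    between {c = c} {k} {h} (here _) refl c<k z≡ k<h h<L
      with p-injective (≤-trans (<-trans c<k (<-trans k<h h<L)) (n≤1+n _)) (≤-trans h<L (n≤1+n _)) z≡
    ... | refl = ⊥-elim (<-irrefl refl (<-trans c<k k<h))
    between {c = c} {k} (step _ a q) refl c<k z≡ k<h h<L
      with interior-neighbours (<-trans c<k (<-trans k<h h<L)) a
    ... | inj₂ eq with suc c ℕ.≟ k
    ...   | yes refl = subst P eq (walkStart q)
    ...   | no c+1≢k = between q eq (≤∧≢⇒< c<k c+1≢k) z≡ k<h h<L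
    between {c = zero} (step _ a q) refl c<k z≡ k<h h<L | inj₁ eq =
      ⊥-elim (r∉mid (P⊆mid r (subst P eq (walkStart q))))
    between {c = suc c} (step _ a q) refl c<k z≡ k<h h<L | inj₁ eq =
      between q eq (<-trans (ℕ.n<1+n c) c<k) z≡ k<h h<L

    segment : ℕ → ℕ → List (Fin m)
    segment lo hi = applyUpTo (λ j → p (j + suc lo)) (suc (hi ∸ lo))

    segment-path : ∀ lo hi → At lo → At hi → (∀ i → At i → lo ≤ i) → (∀ i → At i → i ≤ hi) →
                   IsPath P
    segment-path lo hi (lo<L , P-lo) (hi<L , P-hi) least greatest =
      segment lo hi , unique , linked , λ t → mk⇔ (to t) (from t)
      where
      lo≤hi : lo ≤ hi
      lo≤hi = least hi (hi<L , P-hi)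
      bound : ∀ {j} → j < suc (hi ∸ lo) → j + lo ≤ hi
      bound {j} (s≤s j≤) = subst (j + lo ≤_) (m∸n+n≡m lo≤hi) (+-monoˡ-≤ lo j≤)
      index : ∀ j → j + suc lo ≡ suc (j + lo)
      index j = +-suc j lo
      in-range-segment : ∀ {j} → j < suc (hi ∸ lo) → j + suc lo ≤ suc L
      in-range-segment {j} j< = subst (_≤ suc L) (sym (index j)) (s≤s (≤-trans (bound j<) (<⇒≤ hi<L)))
      unique : Unique (segment lo hi)
      unique = Unique.applyUpTo⁺₁ _ _ λ {i} {j} i<j j< eq →
        <-irrefl (ℕ.+-cancelʳ-≡ (suc lo) i j
                   (p-injective (in-range-segment (<-trans i<j j<)) (in-range-segment j<) eq)) i<j
      linked : Linked Adj (segment lo hi)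
      linked = Linked.applyUpTo⁺₁ _ _ λ {i} i+1< →
        p-adjacent (subst (_≤ L) (sym (index i)) (≤-<-trans (bound (<-trans (ℕ.n<1+n i) i+1<)) hi<L))
      contiguous : ∀ j → lo ≤ j → j ≤ hi → P (p (suc j))
      contiguous j lo≤j j≤hi with m≤n⇒m<n∨m≡n lo≤j | m≤n⇒m<n∨m≡n j≤hi
      ... | inj₂ refl | _ = P-lo
      ... | inj₁ _ | inj₂ refl = P-hi
      ... | inj₁ lo<j | inj₁ j<hi = between (P-connected _ _ P-lo P-hi) refl lo<j refl j<hi hi<L
      to : ∀ t → P t → t ∈ segment lo hi
      to t Pt with interior-p (P⊆mid t Pt)
      ... | k , k<L , refl = subst (_∈ segment lo hi) (cong p position)
            (∈-applyUpTo⁺ (λ j → p (j + suc lo)) (s≤s (∸-monoˡ-≤ lo (greatest k (k<L , Pt)))))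
        where
        position : (k ∸ lo) + suc lo ≡ suc k
        position = trans (index (k ∸ lo)) (cong suc (m∸n+n≡m (least k (k<L , Pt))))
      from : ∀ t → t ∈ segment lo hi → P t
      from t t∈ with ∈-applyUpTo⁻ (λ j → p (j + suc lo)) t∈
      ... | j , j< , refl = subst P (cong p (sym (index j))) (contiguous (j + lo) (m≤n+m lo j) (bound j<))

    is-path : ∀ t → P t → ¬ ¬ IsPath P
    is-path t Pt with interior-p (P⊆mid t Pt)
    ... | k , k<L , refl =
      ¬¬-least At (suc L) k (≤-trans k<L (n≤1+n _)) (k<L , Pt) >>= λ (lo , At-lo , least) →
      ¬¬-greatest At L k (λ i At-i → <⇒≤ (proj₁ At-i)) (k<L , Pt) >>= λ (hi , At-hi , greatest) →
      pure (segment-path lo hi At-lo At-hi least greatest)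

  -- T₀ cut open along e: the interior vertices are deleted and, when
  -- there are none, so is the edge rs itself.
  Outside : VSet m
  Outside t = t ∉ mid

  IsEdgeE : Fin m → Fin m → Set
  IsEdgeE x y = (x ≡ r × y ≡ s) ⊎ (x ≡ s × y ≡ r)

  CutAdj : Fin m → Fin m → Set
  CutAdj x y = Adj x y × (mid ≡ [] → ¬ IsEdgeE x y)

  cut-separates : ¬ Walk CutAdj Outside s r
  cut-separates q with loopErase q
  ... | here _ , _ = r≢s refl
  ... | step out a q' , U =
    unique-path-sr (initVertices q')
      (subst (λ l → Unique (s ∷ l)) (vertices-init q') U)
      (subst (λ l → Linked Adj (s ∷ l)) (vertices-init q') (Linked-map proj₁ (vertices-Linked (step out a q'))))
      (λ {t} t∈ → All-lookup (vertices-All q') (subst (t ∈_) (sym (vertices-init q')) (∈-++⁺ˡ t∈)))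
      (single-edge q' a)
    where
    single-edge : ∀ {y} (q : Walk CutAdj Outside y r) → CutAdj s y → ¬ (mid ≡ [] × initVertices q ≡ [])
    single-edge (here _) a (mid≡[] , _) = proj₂ a mid≡[] (inj₂ (refl , refl))
    single-edge (step _ _ _) a (_ , ())

  substantial-outside : ∀ {t} → Substantial t → Outside t
  substantial-outside St t∈ = St (All-lookup interior-suppressed t∈)

  cut-edge : ∀ {w x y} → ¬ (F w r × F w s) → F w x → F w y → Adj x y → CutAdj x y
  cut-edge ¬both fx fy a = a , λ _ → λ
    { (inj₁ (refl , refl)) → ¬both (fx , fy)
    ; (inj₂ (refl , refl)) → ¬both (fy , fx) }

  OneEnd : Fin n → Fin m → Set
  OneEnd w e′ = ∀ y → F w y → (y ≡ r ⊎ y ≡ s) → y ≡ e′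

  -- A walk inside a subtree F_w that meets {r, s} in at most the vertex e′
  -- can only enter and leave the interior through e′, so its excursions
  -- into the interior can be cut out.
  module Shortcut (w : Fin n) (e′ : Fin m) (one-end : OneEnd w e′) where

    FOut : VSet m
    FOut t = F w t × Outside t

    next-to-interior : ∀ {t y} → t ∈ mid → Adj t y → F w y → Outside y → y ≡ e′
    next-to-interior t∈ a fy y-out with interior-neighbour t∈ a
    ... | inj₁ eq = one-end _ fy (inj₁ eq)
    ... | inj₂ (inj₁ eq) = one-end _ fy (inj₂ eq)
    ... | inj₂ (inj₂ y∈) = ⊥-elim (y-out y∈)

    mutual
      outside : ∀ {y z} → Walk Adj (F w) y z → Outside y → Outside z → Walk Adj FOut y z
      outside (here fy) y-out z-out = here (fy , y-out)
      outside (step {w = y'} fy a q) y-out z-out with y' ∈? mid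
      ... | no y'-out = step (fy , y-out) a (outside q y'-out z-out)
      ... | yes y'∈ = subst (λ x → Walk Adj FOut x _) (sym (next-to-interior y'∈ (Adj-sym a) fy y-out))
                        (inside q y'∈ z-out)

      -- the walk is currently inside the interior, which it entered at e′
      inside : ∀ {t z} → Walk Adj (F w) t z → t ∈ mid → Outside z → Walk Adj FOut e′ z
      inside (here _) t∈ z-out = ⊥-elim (z-out t∈)
      inside (step {w = y'} _ a q) t∈ z-out with y' ∈? mid
      ... | yes y'∈ = inside q y'∈ z-out
      ... | no y'-out = subst (λ x → Walk Adj FOut x _) (next-to-interior t∈ a (walkStart q) y'-out)
                          (outside q y'-out z-out)

  -- a T₀-path x … y avoiding the interior is not the path of e (unless it
  -- is the single edge rs, which the last hypothesis excludes)
  not-e : ∀ x acc y → Unique (x ∷ acc ++ [ y ]) → Linked Adj (x ∷ acc ++ [ y ]) → All Outside acc →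
          (mid ≡ [] → acc ≡ [] → ¬ IsEdgeE x y) → ¬ IsEdgeE x y
  not-e x acc y U Lk out single (inj₁ (refl , refl)) =
    unique-path-rs acc U Lk (All-lookup out) (λ (mid≡[] , acc≡[]) → single mid≡[] acc≡[] (inj₁ (refl , refl)))
  not-e x acc y U Lk out single (inj₂ (refl , refl)) =
    unique-path-sr acc U Lk (All-lookup out) (λ (mid≡[] , acc≡[]) → single mid≡[] acc≡[] (inj₂ (refl , refl)))

  -- A path in the cut tree between substantial vertices yields a walk in
  -- T - e: each maximal run of suppressed vertices between two substantial
  -- ones is an edge of T, and it is not e by `not-e`.
  module ToBaseTree (b : Fin m) (Sb : Substantial b) where

    -- x acc y is the part of the path read so far since the last
    -- substantial vertex x; q is the rest of the path
    collapse : ∀ {y} x acc (q : Walk CutAdj Outside y b) → Substantial x →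
               Unique (x ∷ acc ++ vertices q) → Linked Adj (x ∷ acc ++ [ y ]) →
               All Suppressed acc → All Outside acc → (mid ≡ [] → acc ≡ [] → ¬ IsEdgeE x y) →
               ¬ ¬ Walk TAdj-e Substantial x b
    collapse x acc (here _) Sx U Lk supp out single =
      pure (step Sx ((acc , Sx , Sb , supp , U , Lk) , not-e x acc b U Lk out single) (here Sb))
    collapse {y} x acc (step {w = y'} y-out a q) Sx U Lk supp out single = ¬¬-excluded-middle >>= continue
      where
      U-cut : Unique (x ∷ acc ++ [ y ])
      U-cut = Unique-cut (x ∷ acc) U
      continue : Dec (Suppressed y) → ¬ ¬ Walk TAdj-e Substantial x b
      continue (no Sy) =
        collapse y [] q Sy (Unique-++ʳ (x ∷ acc) U) (proj₁ a ∷ [-]) [] [] (λ mid≡[] _ → proj₂ a mid≡[]) >>= λ rest →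
        pure (step Sx ((acc , Sx , Sy , supp , U-cut , Lk) , not-e x acc y U-cut Lk out single) rest)
      continue (yes suppressed-y) =
        collapse x (acc ++ [ y ]) q Sx
          (subst (λ l → Unique (x ∷ l)) (sym (++-assoc acc [ y ] (vertices q))) U)
          (subst (λ l → Linked Adj (x ∷ l)) (sym (++-assoc acc [ y ] [ y' ])) (Linked-join (x ∷ acc) Lk (proj₁ a ∷ [-])))
          (All.++⁺ supp (suppressed-y ∷ [])) (All.++⁺ out (y-out ∷ []))
          (λ _ acc+y≡[] → case ++-conicalʳ acc [ y ] acc+y≡[] of λ ())

    to-base-tree : ∀ {x} → Substantial x → (q : Walk CutAdj Outside x b) → Unique (vertices q) →
                   ¬ ¬ Walk TAdj-e Substantial x b
    to-base-tree Sx (here _) _ = pure (here Sx)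
    to-base-tree Sx (step _ a q) U = collapse _ [] q Sx U (proj₁ a ∷ [-]) [] [] (λ mid≡[] _ → proj₂ a mid≡[])

  module Separator (C S : VSet n) (cover : VertexCover C)
                   (S-black : Black → ∀ v → S v ⇔ C v)
                   (S-red : ∀ x → Corresponds x → ∀ v → S v ⇔ (C v ⊎ v ≡ x))
                   (col : Colour) where

    cover⊆S : ∀ {w} → C w → S w
    cover⊆S {w} = by-colour col
      where
      by-colour : Colour → C w → S w
      by-colour (inj₁ black) = Equivalence.from (S-black black w)
      by-colour (inj₂ (x , cx)) c = Equivalence.from (S-red x cx w) (inj₁ c)

    -- if e is red with I-path F_x, then x ∈ S, and no other I-path meets F_x
    red-I-avoids : ∀ {w t} x → Corresponds x → ¬ S w → I w → F w t → t ∈ verts → ⊥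
    red-I-avoids {w} {t} x cx ¬Sw Iw ft t∈ with w ≟ x
    ... | yes refl = ¬Sw (Equivalence.from (S-red x cx w) (inj₂ refl))
    ... | no w≢x = I-indep w x Iw (proj₁ cx) (share→adj w≢x ft (Equivalence.from (proj₂ cx t) t∈))

    -- if e is black, an I-path through an interior vertex would contain a
    -- (red) edge of the path
    black-I-avoids : Black → ∀ {w t} → I w → F w t → t ∈ mid → ⊥
    black-I-avoids black {w} Iw ft t∈ with interior-p t∈
    ... | k , k< , refl = IPath.continues-back Iw k< ft λ fk →
          black-edge black (≤-trans (n≤1+n k) k<) (w , Iw , fk , ft)

    I-avoids-interior : ∀ {w t} → ¬ S w → I w → F w t → t ∈ mid → ⊥
    I-avoids-interior ¬Sw Iw ft t∈ = by-colour col
      where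
      by-colour : Colour → ⊥
      by-colour (inj₁ black) = black-I-avoids black Iw ft t∈
      by-colour (inj₂ (x , cx)) = red-I-avoids x cx ¬Sw Iw ft (interior⊆verts t∈)

    -- no subtree outside S contains both ends of e: for w ∉ I it would be
    -- a loop of the overspan graph; for w ∈ I and e red it would meet F_x;
    -- for w ∈ I and e black it would either meet the interior or join r
    -- and s in the cut tree
    not-both-ends : ∀ {w} → ¬ S w → F w r → F w s → ⊥
    not-both-ends {w} ¬Sw fr fs = ¬¬-excluded-middle λ
      { (no ¬Iw) → ¬Sw (cover⊆S (proj₁ (proj₂ cover) w ¬Iw fr fs))
      ; (yes Iw) → I-case Iw col }
      where
      I-case : I w → Colour → ⊥
      I-case Iw (inj₂ (x , cx)) = red-I-avoids x cx ¬Sw Iw fr (here refl)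
      I-case Iw (inj₁ black) = ¬¬-excluded-middle {A = ∃ λ t → F w t × t ∈ mid} λ
        { (yes (t , ft , t∈)) → black-I-avoids black Iw ft t∈
        ; (no avoids) → cut-separates
            (walkMap (λ {y} fy y∈ → avoids (y , fy , y∈))
                     (λ _ _ a → a , λ mid≡[] _ → black-edge-rs black mid≡[] (w , Iw , fr , fs))
                     (subtree-connected w s r fs fr)) }

    stays-inside : ∀ {w t y} → ¬ F w r → ¬ F w s → Walk Adj (F w) t y → t ∈ mid → y ∈ mid
    stays-inside ¬fr ¬fs (here _) t∈ = t∈
    stays-inside ¬fr ¬fs (step _ a q) t∈ with interior-neighbour t∈ a
    ... | inj₁ refl = ⊥-elim (¬fr (walkStart q))
    ... | inj₂ (inj₁ refl) = ⊥-elim (¬fs (walkStart q))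
    ... | inj₂ (inj₂ y∈) = stays-inside ¬fr ¬fs q y∈

    -- a subtree outside S meeting the interior contains an end of e.
    -- Otherwise it lies inside the path: if e is red it is a proper part
    -- of the I-path F_x, contradicting the minimality of I; if e is black
    -- it is a path of degree-2 vertices meeting no I-path, contradicting
    -- the maximality of I.
    meets-end : ∀ {w t} → ¬ S w → F w t → t ∈ mid → ¬ F w r → ¬ F w s → ⊥
    meets-end {w} {t} ¬Sw ft t∈ ¬fr ¬fs = by-colour col
      where
      ¬Iw : ¬ I w
      ¬Iw Iw = I-avoids-interior ¬Sw Iw ft t∈
      inside : ∀ y → F w y → y ∈ mid
      inside y fy = stays-inside ¬fr ¬fs (subtree-connected w t y ft fy) t∈
      J : VSet n
      J v = I v ⊎ v ≡ w
      J-independent : Black → Independent G J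
      J-independent _ u v (inj₁ Iu) (inj₁ Iv) adj = I-indep u v Iu Iv adj
      J-independent black u v (inj₁ Iu) (inj₂ refl) adj with adj→share adj
      ... | y , fu , fv = black-I-avoids black Iu fu (inside y fv)
      J-independent black u v (inj₂ refl) (inj₁ Iv) adj with adj→share adj
      ... | y , fu , fv = black-I-avoids black Iv fv (inside y fu)
      J-independent _ u v (inj₂ refl) (inj₂ refl) adj = Graph.irrefl G adj
      J-shape : IsPath (F w) → ∀ v → J v → PathShape v
      J-shape _ v (inj₁ Iv) = I-shape v Iv
      J-shape path v (inj₂ refl) = path , λ y fy → interior-degree≤2 (inside y fy)
      by-colour : Colour → ⊥
      by-colour (inj₂ (x , cx)) =
        I-minimal x (proj₁ cx)
          (w , (λ y fy → Equivalence.from (proj₂ cx y) (interior⊆verts (inside y fy))) ,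
               λ F-x⊆F-w → ¬fr (F-x⊆F-w r (Equivalence.from (proj₂ cx r) (here refl))))
      by-colour (inj₁ black) = InteriorSegment.is-path (F w) (subtree-connected w) inside t ft λ path →
        ¬Iw (I-maximal J (λ _ → inj₁) (J-independent black) (J-shape path) w (inj₂ refl))

    -- adjacent vertices outside S whose subtrees meet in the interior do
    -- not contain opposite ends of e: neither is in I, so their edge would
    -- be an edge of the overspan graph not covered by C
    no-crossing : ∀ {w w' t} → ¬ S w → ¬ S w' → Graph.Adj G w w' → F w t → F w' t → t ∈ mid →
                  ¬ ((F w r × F w' s) ⊎ (F w s × F w' r))
    no-crossing {w} {w'} ¬Sw ¬Sw' adj ft ft' t∈ ends
      with proj₂ (proj₂ cover) w w' (λ Iw → I-avoids-interior ¬Sw Iw ft t∈)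
             (λ Iw' → I-avoids-interior ¬Sw' Iw' ft' t∈) (λ { refl → Graph.irrefl G adj }) adj ends
    ... | inj₁ c = ¬Sw (cover⊆S c)
    ... | inj₂ c = ¬Sw' (cover⊆S c)

    shared-end : ∀ {w w' t} → ¬ S w → ¬ S w' → Graph.Adj G w w' → F w t → F w' t → t ∈ mid →
                 ¬ ¬ (∃ λ z → (z ≡ r ⊎ z ≡ s) × F w z × F w' z)
    shared-end ¬Sw ¬Sw' adj ft ft' t∈ ¬shared =
      meets-end ¬Sw ft t∈
        (λ fr → meets-end ¬Sw' ft' t∈ (λ fr' → ¬shared (r , inj₁ refl , fr , fr'))
                                      (λ fs' → crossing (inj₁ (fr , fs'))))
        (λ fs → meets-end ¬Sw' ft' t∈ (λ fr' → crossing (inj₂ (fs , fr')))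
                                      (λ fs' → ¬shared (s , inj₂ refl , fs , fs')))
      where crossing = no-crossing ¬Sw ¬Sw' adj ft ft' t∈

    end-outside : ∀ {z} → z ≡ r ⊎ z ≡ s → Outside z
    end-outside (inj₁ refl) = r∉mid
    end-outside (inj₂ refl) = s∉mid

    -- Fix a vertex a of T₀.  A subtree is covered if all its vertices
    -- outside the interior are reachable from a in the cut tree.  Being
    -- covered propagates along walks of G - S.
    module Reach (a : Fin m) where

      Reachable : Fin m → Set
      Reachable y = Walk CutAdj Outside a y

      Covered : Fin n → Set
      Covered w = ∀ y → F w y → Outside y → ¬ ¬ Reachable y

      -- one reachable vertex suffices: F_w contains at most one end e′,
      -- and walks inside F_w can be shortcut to avoid the interior
      covered-from : ∀ {w q} → ¬ S w → F w q → Outside q → Reachable q → Covered w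
      covered-from {w} {q} ¬Sw fq q-out reach-q y fy y-out =
        ¬¬-excluded-middle >>= λ r? → pure (reach-q ++ʷ cut-walk (the-end r?))
        where
        the-end : Dec (F w r) → Σ (Fin m) (OneEnd w)
        the-end (yes fr) = r , λ { _ _ (inj₁ eq) → eq ; _ fs (inj₂ refl) → ⊥-elim (not-both-ends ¬Sw fr fs) }
        the-end (no ¬fr) = s , λ { _ fr (inj₁ refl) → ⊥-elim (¬fr fr) ; _ _ (inj₂ eq) → eq }
        cut-walk : Σ (Fin m) (OneEnd w) → Walk CutAdj Outside q y
        cut-walk (e′ , one-end) =
          walkMap proj₂ (λ (fx , _) (fy , _) a → cut-edge (λ (fr , fs) → not-both-ends ¬Sw fr fs) fx fy a)
            (Shortcut.outside w e′ one-end (subtree-connected w q y fq fy) q-out y-out)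

      -- coverage passes along an edge of G - S, through a shared vertex of
      -- the two subtrees or, if that is interior, through a shared end of e
      covered-step : ∀ {w w'} → ¬ S w → ¬ S w' → Graph.Adj G w w' → Covered w → Covered w'
      covered-step ¬Sw ¬Sw' adj cov y fy y-out with adj→share adj
      ... | t , ft , ft' with t ∈? mid
      ... | no t-out = cov t ft t-out >>= λ reach-t → covered-from ¬Sw' ft' t-out reach-t y fy y-out
      ... | yes t∈ = shared-end ¬Sw ¬Sw' adj ft ft' t∈ >>= λ (z , z-end , fz , fz') →
                     cov z fz (end-outside z-end) >>= λ reach-z →
                     covered-from ¬Sw' fz' (end-outside z-end) reach-z y fy y-out

      covered-along : ∀ {x z} → Walk (Graph.Adj G) (λ w → ¬ S w) x z → Covered x → Covered z
      covered-along (here _) cov = cov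
      covered-along (step ¬Sx adj q) cov = covered-along q (covered-step ¬Sx (walkStart q) adj cov)

    -- the theorem, for a given colour of e: if u, v ∉ S were joined in
    -- G - S, the subtree of v would be covered starting from a ∈ F_u, so b
    -- would be reachable from a in the cut tree and hence in T - e
    separates : ∀ u v → Enclosing u v → ¬ Walk (Graph.Adj G) (λ w → ¬ S w) u v
    separates u v (a , b , Sa , fa , Sb , fb , ¬connected) walk =
      covered-v b fb (substantial-outside Sb) λ reach-b →
        let (q , U) = loopErase reach-b in ToBaseTree.to-base-tree b Sb Sa q U ¬connected
      where
      open Reach a
      covered-v : Covered v
      covered-v = covered-along walk (covered-from (walkStart walk) fa (substantial-outside Sa) (here (substantial-outside Sa)))

-- The theorem: the colour of e is only known up to double negation,
-- which suffices because the conclusion is a negation.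
lemma4p3 : ∀ {n m} (B : BaseSetup n m) (e : BaseSetup.TEdge B)
    (C : VSet n) → BaseSetup.TEdge.VertexCover e C →
    (S : VSet n) →
    (BaseSetup.TEdge.Black e → ∀ v → S v ⇔ C v) →
    (∀ x → BaseSetup.TEdge.Corresponds e x → ∀ v → S v ⇔ (C v ⊎ v ≡ x)) →
    ∀ u v → ¬ S u → ¬ S v → BaseSetup.TEdge.Enclosing e u v →
    ¬ Walk (Graph.Adj (BaseSetup.G B)) (λ w → ¬ S w) u v
lemma4p3 B e C cover S S-black S-red u v _ _ enclosing walk =
  colour λ col → Separator.separates C S cover S-black S-red col u v enclosing walk
  where open EdgePath B e
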